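{- Let $\mathbb{D}$ be a countable set, $(G,+)$ a commutative group, and $V$ a finite, reversible set of data vectors $\mathbb{D}\to G$ with $\bigcup_{\vec{v}\in V}\mathrm{supp}(\vec{v})\subsetneq\mathbb{D}$. A data vector $\vec{x}:\mathbb{D}\to G$ is a permutation sum of $V$ if and only if (1) $\mathrm{weight}(\vec{x})$ lies in the subgroup of $G$ generated by $\{\mathrm{weight}(\vec{v})\mid\vec{v}\in V\}$, and (2) for every $\alpha\in\mathbb{D}$, $\vec{x}(\alpha)$ lies in the subgroup of $G$ generated by $\{\vec{v}(\delta)\mid\delta\in\mathbb{D},\ \vec{v}\in V\}$.
   Context: A data vector is a function $\mathbb{D}\to G$ with finite support $\mathrm{supp}(\vec{v})=\{\alpha\mid\vec{v}(\alpha)\neq0\}$; addition and negation are pointwise. $\vec{y}$ is a permutation sum of $V$ if $\vec{y}=\sum_{i=1}^n\vec{v_i}\circ\theta_i$ for some $n\in\mathbb{N}$, $\vec{v_i}\in V$ (repetitions allowed) and permutations $\theta_i$ of $\mathbb{D}$. $V$ is reversible if for every $\vec{v}\in V$ both $\vec{v}$ and $-\vec{v}$ are permutation sums of $V$. $\mathrm{weight}(\vec{v})=\sum_{\alpha\in\mathbb{D}}\vec{v}(\alpha)$. -}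

module Defs where

open import Level using (Level; _⊔_)
open import Data.Nat using (ℕ)
open import Data.List using (List; []; _∷_; foldr)
open import Data.List.Membership.Propositional using (_∈_; _∉_)
open import Data.List.Relation.Unary.Unique.Propositional using (Unique)
open import Data.Product using (Σ; _×_; _,_; ∃)
open import Function.Bundles using (_↔_; Inverse)
open import Algebra.Bundles using (AbelianGroup)

module _ {c ℓ : Level} (G : AbelianGroup c ℓ) (D : Set) where
  open AbelianGroup G

  -- A data vector: a function D → G together with a duplicate-free list
  -- of points covering its support (so the support is finite).
  record DataVec : Set (c ⊔ ℓ) where
    constructor mkDV
    field
      fn   : D → Carrier
      dom  : List D
      uniq : Unique dom
      fin  : ∀ α → α ∉ dom → fn α ≈ ε
  open DataVec public

  weight : DataVec → Carrier
  weight v = foldr (λ α acc → fn v α ∙ acc) ε (dom v)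

  termSum : List (DataVec × (D ↔ D)) → D → Carrier
  termSum [] α = ε
  termSum ((v , θ) ∷ ts) α = fn v (Inverse.to θ α) ∙ termSum ts α

  AllIn : List DataVec → List (DataVec × (D ↔ D)) → Set (c ⊔ ℓ)
  AllIn V [] = Level.Lift _ Data.Unit.⊤ where import Data.Unit
  AllIn V ((v , θ) ∷ ts) = (v ∈ V) × AllIn V ts

  PermSum : List DataVec → (D → Carrier) → Set (c ⊔ ℓ)
  PermSum V y = Σ (List (DataVec × (D ↔ D))) λ ts →
    AllIn V ts × (∀ α → y α ≈ termSum ts α)

  Reversible : List DataVec → Set (c ⊔ ℓ)
  Reversible V = ∀ v → v ∈ V → PermSum V (fn v) × PermSum V (λ α → fn v α ⁻¹)

  data InSubgroup (S : Carrier → Set (c ⊔ ℓ)) : Carrier → Set (c ⊔ ℓ) where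
    gen  : ∀ {g} → S g → InSubgroup S g
    zero : InSubgroup S ε
    add  : ∀ {g h} → InSubgroup S g → InSubgroup S h → InSubgroup S (g ∙ h)
    neg  : ∀ {g} → InSubgroup S g → InSubgroup S (g ⁻¹)
    resp : ∀ {g h} → g ≈ h → InSubgroup S g → InSubgroup S h

  Weights : List DataVec → Carrier → Set (c ⊔ ℓ)
  Weights V g = Σ DataVec λ v → (v ∈ V) × (g ≈ weight v)

  Entries : List DataVec → Carrier → Set (c ⊔ ℓ)
  Entries V g = Σ DataVec λ v → (v ∈ V) × Σ D λ δ → g ≈ fn v δ

module Submission where

open import Defs
open import Level using (Level; _⊔_)
open import Data.Nat using (ℕ)
open import Data.Product using (Σ; _×_)
open import Data.List using (List)
open import Data.List.Membership.Propositional using (_∈_)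
open import Function.Bundles using (_↣_; _⇔_)
open import Algebra.Bundles using (AbelianGroup)

open import Algebra.Bundles using (CommutativeMonoid)
import Algebra.Properties.AbelianGroup as AbelianGroupProperties
import Algebra.Properties.CommutativeSemigroup as CommutativeSemigroupProperties
open import Data.Empty using (⊥-elim)
open import Data.List using ([]; _∷_; _++_; map; filter; length)
open import Data.List.Properties using (foldr-map; length-filter)
open import Data.List.Membership.Propositional using (_∉_)
import Data.List.Membership.DecPropositional as DecMembership
open import Data.List.Relation.Unary.All as All using (All; []; _∷_)
open import Data.List.Relation.Unary.All.Properties using (all-filter; ¬Any⇒All¬; All¬⇒¬Any)
open import Data.List.Relation.Unary.AllPairs using (_∷_)
open import Data.List.Relation.Unary.Any using (here; there)
open import Data.List.Relation.Unary.Unique.Propositional using (Unique)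
import Data.Nat as ℕ
open import Data.Nat.Properties using (≤-refl; ≤-trans)
open import Data.Product using (_,_; proj₁; proj₂; map₁; map₂)
open import Function.Base using (_∘_)
open import Function.Bundles using (_↔_; Inverse; mk↔ₛ′; mk⇔)
open import Function.Construct.Composition using (_↔-∘_)
open import Function.Construct.Identity using (↔-id)
open import Relation.Binary.Definitions using (DecidableEquality)
open import Relation.Binary.PropositionalEquality as ≡ using (_≡_; _≢_; ≢-sym)
open import Relation.Nullary.Decidable using (Dec; yes; no; via-injection)
open import Relation.Unary using (Pred; Decidable)
open import Relation.Unary.Properties using (∁?)

-- Fix a point β outside all supports (the hypothesis on V).  For an entry g = v(δ) and any
-- point a, the dipole δ_a g − δ_β g equals v∘(a δ) − v∘(a δ)∘(a β), a permutation sum by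
-- reversibility; since dipoles are additive in their charge, this extends to every charge g
-- in the entry subgroup H.  A vector x with entries in H is the sum of the dipoles
-- δ_α x(α) − δ_β x(α) plus δ_β weight(x), and δ_β weight(v) = v − (dipoles of v) for v ∈ V;
-- so condition (2) handles the dipoles and condition (1) the point mass at β.  Conversely,
-- entries of a permutation sum are sums of entries, and its weight is the sum of the weights
-- of its terms: writing vectors as finite formal sums of point masses, the total mass depends
-- only on the function represented, because a formal sum vanishing everywhere has total mass
-- zero (collect the masses sitting at one point and recurse on the rest).

module ListSum {c ℓ : Level} (M : CommutativeMonoid c ℓ) where

  open CommutativeMonoid M
  open CommutativeSemigroupProperties commutativeSemigroup using (interchange; x∙yz≈y∙xz)

  private
    variable
      a p : Level
      A B : Set a

  sumOver : (A → Carrier) → List A → Carrier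
  sumOver f = Data.List.foldr (λ x acc → f x ∙ acc) ε

  sumOver-map : (f : B → Carrier) (g : A → B) (xs : List A) →
                sumOver f (map g xs) ≡ sumOver (f ∘ g) xs
  sumOver-map f g = foldr-map _ g ε

  sumOver-cong : {f g : A → Carrier} → (∀ x → f x ≈ g x) → ∀ xs → sumOver f xs ≈ sumOver g xs
  sumOver-cong f≈g []       = refl
  sumOver-cong f≈g (x ∷ xs) = ∙-cong (f≈g x) (sumOver-cong f≈g xs)

  sumOver-congᴬ : {f g : A → Carrier} {xs : List A} →
                  All (λ x → f x ≈ g x) xs → sumOver f xs ≈ sumOver g xs
  sumOver-congᴬ []           = refl
  sumOver-congᴬ (fx≈gx ∷ eq) = ∙-cong fx≈gx (sumOver-congᴬ eq)

  sumOver-ε : {f : A → Carrier} {xs : List A} → All (λ x → f x ≈ ε) xs → sumOver f xs ≈ ε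
  sumOver-ε []          = refl
  sumOver-ε (fx≈ε ∷ eq) = trans (∙-cong fx≈ε (sumOver-ε eq)) (identityˡ ε)

  sumOver-++ : (f : A → Carrier) (xs ys : List A) →
               sumOver f (xs ++ ys) ≈ sumOver f xs ∙ sumOver f ys
  sumOver-++ f []       ys = sym (identityˡ _)
  sumOver-++ f (x ∷ xs) ys = trans (∙-congˡ (sumOver-++ f xs ys)) (sym (assoc _ _ _))

  sumOver-∙ : (f g : A → Carrier) (xs : List A) →
              sumOver (λ x → f x ∙ g x) xs ≈ sumOver f xs ∙ sumOver g xs
  sumOver-∙ f g []       = sym (identityˡ ε)
  sumOver-∙ f g (x ∷ xs) = trans (∙-congˡ (sumOver-∙ f g xs)) (interchange _ _ _ _)

  sumOver-partition : {P : Pred A p} (P? : Decidable P) (f : A → Carrier) (xs : List A) →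
                      sumOver f xs ≈ sumOver f (filter P? xs) ∙ sumOver f (filter (∁? P?) xs)
  sumOver-partition P? f []       = sym (identityˡ ε)
  sumOver-partition P? f (x ∷ xs) with P? x
  ... | yes _ = trans (∙-congˡ (sumOver-partition P? f xs)) (sym (assoc _ _ _))
  ... | no  _ = trans (∙-congˡ (sumOver-partition P? f xs)) (x∙yz≈y∙xz _ _ _)

  sumOver-homo : (h : Carrier → Carrier) → (∀ {x y} → x ≈ y → h x ≈ h y) → h ε ≈ ε →
                 (∀ x y → h (x ∙ y) ≈ h x ∙ h y) →
                 (f : A → Carrier) (xs : List A) → h (sumOver f xs) ≈ sumOver (h ∘ f) xs
  sumOver-homo h h-cong h-ε h-∙ f []       = h-ε
  sumOver-homo h h-cong h-ε h-∙ f (x ∷ xs) =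
    trans (h-∙ _ _) (∙-congˡ (sumOver-homo h h-cong h-ε h-∙ f xs))

module Transposition {D : Set} (_≟_ : DecidableEquality D) where

  transpose : D → D → D → D
  transpose a b x with x ≟ a
  ... | yes _ = b
  ... | no  _ with x ≟ b
  ...   | yes _ = a
  ...   | no  _ = x

  transpose-left : ∀ a b → transpose a b a ≡ b
  transpose-left a b with a ≟ a
  ... | yes _   = ≡.refl
  ... | no  a≢a = ⊥-elim (a≢a ≡.refl)

  transpose-right : ∀ a b → transpose a b b ≡ a
  transpose-right a b with b ≟ a
  ... | yes b≡a = b≡a
  ... | no  _ with b ≟ b
  ...   | yes _   = ≡.refl
  ...   | no  b≢b = ⊥-elim (b≢b ≡.refl)

  transpose-other : ∀ {a b x} → x ≢ a → x ≢ b → transpose a b x ≡ x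
  transpose-other {a} {b} {x} x≢a x≢b with x ≟ a
  ... | yes x≡a = ⊥-elim (x≢a x≡a)
  ... | no  _ with x ≟ b
  ...   | yes x≡b = ⊥-elim (x≢b x≡b)
  ...   | no  _   = ≡.refl

  transpose-involutive : ∀ a b x → transpose a b (transpose a b x) ≡ x
  transpose-involutive a b x with x ≟ a
  ... | yes ≡.refl = transpose-right a b
  ... | no  x≢a with x ≟ b
  ...   | yes ≡.refl = transpose-left a b
  ...   | no  x≢b    = transpose-other x≢a x≢b

  transposition : D → D → D ↔ D
  transposition a b = mk↔ₛ′ (transpose a b) (transpose a b)
    (transpose-involutive a b) (transpose-involutive a b)

module PointwiseHomomorphisms {c ℓ : Level} (G : AbelianGroup c ℓ) (D : Set) where

  open AbelianGroup G
  open AbelianGroupProperties G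
  open CommutativeSemigroupProperties commutativeSemigroup using (interchange)
  open ListSum commutativeMonoid
  open import Relation.Binary.Reasoning.Setoid setoid

  record IsPointwiseHom (φ : Carrier → D → Carrier) : Set (c ⊔ ℓ) where
    field
      cong    : ∀ {g h} → g ≈ h → ∀ x → φ g x ≈ φ h x
      ∙-homo  : ∀ g h x → φ (g ∙ h) x ≈ φ g x ∙ φ h x
      ⁻¹-homo : ∀ g x → φ (g ⁻¹) x ≈ φ g x ⁻¹

    ε-homo : ∀ x → φ ε x ≈ ε
    ε-homo x = identityˡ-unique (φ ε x) (φ ε x)
      (sym (trans (cong (sym (identityʳ ε)) x) (∙-homo ε ε x)))

    sumOver-homoᵖ : ∀ {a} {A : Set a} (f : A → Carrier) xs x →
                    φ (sumOver f xs) x ≈ sumOver (λ y → φ (f y) x) xs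
    sumOver-homoᵖ f xs x =
      sumOver-homo (λ g → φ g x) (λ g≈h → cong g≈h x) (ε-homo x) (λ g h → ∙-homo g h x) f xs

  quotient-isPointwiseHom : ∀ {φ ψ} → IsPointwiseHom φ → IsPointwiseHom ψ →
                            IsPointwiseHom (λ g x → φ g x ∙ ψ g x ⁻¹)
  quotient-isPointwiseHom {φ} {ψ} φ-hom ψ-hom = record
    { cong    = λ g≈h x → ∙-cong (Φ.cong g≈h x) (⁻¹-cong (Ψ.cong g≈h x))
    ; ∙-homo  = ∙-homo
    ; ⁻¹-homo = λ g x → trans (∙-cong (Φ.⁻¹-homo g x) (⁻¹-cong (Ψ.⁻¹-homo g x)))
                              (⁻¹-∙-comm _ _)
    }
    where
    module Φ = IsPointwiseHom φ-hom
    module Ψ = IsPointwiseHom ψ-hom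
    ∙-homo : ∀ g h x → φ (g ∙ h) x ∙ ψ (g ∙ h) x ⁻¹ ≈ (φ g x ∙ ψ g x ⁻¹) ∙ (φ h x ∙ ψ h x ⁻¹)
    ∙-homo g h x = begin
      φ (g ∙ h) x ∙ ψ (g ∙ h) x ⁻¹          ≈⟨ ∙-cong (Φ.∙-homo g h x) (⁻¹-cong (Ψ.∙-homo g h x)) ⟩
      (φ g x ∙ φ h x) ∙ (ψ g x ∙ ψ h x) ⁻¹  ≈⟨ ∙-congˡ (⁻¹-∙-comm _ _) ⟨
      (φ g x ∙ φ h x) ∙ (ψ g x ⁻¹ ∙ ψ h x ⁻¹) ≈⟨ interchange _ _ _ _ ⟩
      (φ g x ∙ ψ g x ⁻¹) ∙ (φ h x ∙ ψ h x ⁻¹) ∎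

module PointMasses {c ℓ : Level} (G : AbelianGroup c ℓ) (D : Set) (_≟_ : DecidableEquality D) where

  open AbelianGroup G
  open AbelianGroupProperties G
  open ListSum commutativeMonoid public
  open PointwiseHomomorphisms G D public
  open Transposition _≟_
  open import Relation.Binary.Reasoning.Setoid setoid

  δ : D → Carrier → D → Carrier
  δ a g x with x ≟ a
  ... | yes _ = g
  ... | no  _ = ε

  δ-at : ∀ a g → δ a g a ≈ g
  δ-at a g with a ≟ a
  ... | yes _   = refl
  ... | no  a≢a = ⊥-elim (a≢a ≡.refl)

  δ-off : ∀ {a x} g → x ≢ a → δ a g x ≈ ε
  δ-off {a} {x} g x≢a with x ≟ a
  ... | yes x≡a = ⊥-elim (x≢a x≡a)
  ... | no  _   = refl

  δ-transport : ∀ (θ : D ↔ D) a g x → δ (Inverse.from θ a) g x ≈ δ a g (Inverse.to θ x)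
  δ-transport θ a g x with x ≟ Inverse.from θ a | Inverse.to θ x ≟ a
  ... | yes _    | yes _    = refl
  ... | no  _    | no  _    = refl
  ... | yes x≡θa | no  θx≢a =
    ⊥-elim (θx≢a (≡.trans (≡.cong (Inverse.to θ) x≡θa) (Inverse.strictlyInverseˡ θ a)))
  ... | no  x≢θa | yes θx≡a =
    ⊥-elim (x≢θa (≡.trans (≡.sym (Inverse.strictlyInverseʳ θ x)) (≡.cong (Inverse.from θ) θx≡a)))

  δ-isPointwiseHom : ∀ a → IsPointwiseHom (δ a)
  δ-isPointwiseHom a = record { cong = cong ; ∙-homo = ∙-homo ; ⁻¹-homo = ⁻¹-homo }
    where
    cong : ∀ {g h} → g ≈ h → ∀ x → δ a g x ≈ δ a h x
    cong g≈h x with x ≟ a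
    ... | yes _ = g≈h
    ... | no  _ = refl
    ∙-homo : ∀ g h x → δ a (g ∙ h) x ≈ δ a g x ∙ δ a h x
    ∙-homo g h x with x ≟ a
    ... | yes _ = refl
    ... | no  _ = sym (identityˡ ε)
    ⁻¹-homo : ∀ g x → δ a (g ⁻¹) x ≈ δ a g x ⁻¹
    ⁻¹-homo g x with x ≟ a
    ... | yes _ = refl
    ... | no  _ = sym ε⁻¹≈ε

  dipole : D → D → Carrier → D → Carrier
  dipole a b g x = δ a g x ∙ δ b g x ⁻¹

  dipole-isPointwiseHom : ∀ a b → IsPointwiseHom (dipole a b)
  dipole-isPointwiseHom a b = quotient-isPointwiseHom (δ-isPointwiseHom a) (δ-isPointwiseHom b)

  module δ-hom (a : D) = IsPointwiseHom (δ-isPointwiseHom a)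
  module dipole-hom (a b : D) = IsPointwiseHom (dipole-isPointwiseHom a b)

  dipole-self : ∀ a g x → dipole a a g x ≈ ε
  dipole-self a g x = inverseʳ _

  δ≈dipole∙δ : ∀ a b g x → δ a g x ≈ dipole a b g x ∙ δ b g x
  δ≈dipole∙δ a b g x = sym (trans (assoc _ _ _) (trans (∙-congˡ (inverseˡ _)) (identityʳ _)))

  dipole-transpose : (f : D → Carrier) → ∀ {a b} → f b ≈ ε → a ≢ b →
                     ∀ x → f x ∙ f (transpose a b x) ⁻¹ ≈ dipole a b (f a) x
  dipole-transpose f {a} {b} fb≈ε a≢b x = by-cases x (x ≟ a) (x ≟ b)
    where
    by-cases : ∀ y → Dec (y ≡ a) → Dec (y ≡ b) → f y ∙ f (transpose a b y) ⁻¹ ≈ dipole a b (f a) y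
    by-cases _ (yes ≡.refl) _ = begin
      f a ∙ f (transpose a b a) ⁻¹ ≈⟨ ∙-congˡ (⁻¹-cong (reflexive (≡.cong f (transpose-left a b)))) ⟩
      f a ∙ f b ⁻¹                 ≈⟨ ∙-congˡ (⁻¹-cong fb≈ε) ⟩
      f a ∙ ε ⁻¹                   ≈⟨ ∙-cong (δ-at a (f a)) (⁻¹-cong (δ-off (f a) a≢b)) ⟨
      dipole a b (f a) a           ∎
    by-cases _ (no b≢a) (yes ≡.refl) = begin
      f b ∙ f (transpose a b b) ⁻¹ ≈⟨ ∙-congˡ (⁻¹-cong (reflexive (≡.cong f (transpose-right a b)))) ⟩
      f b ∙ f a ⁻¹                 ≈⟨ ∙-congʳ fb≈ε ⟩
      ε ∙ f a ⁻¹                   ≈⟨ ∙-cong (δ-off (f a) b≢a) (⁻¹-cong (δ-at b (f a))) ⟨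
      dipole a b (f a) b           ∎
    by-cases y (no y≢a) (no y≢b) = begin
      f y ∙ f (transpose a b y) ⁻¹ ≈⟨ ∙-congˡ (⁻¹-cong (reflexive (≡.cong f (transpose-other y≢a y≢b)))) ⟩
      f y ∙ f y ⁻¹                 ≈⟨ inverseʳ _ ⟩
      ε                            ≈⟨ inverseʳ ε ⟨
      ε ∙ ε ⁻¹                     ≈⟨ ∙-cong (δ-off (f a) y≢a) (⁻¹-cong (δ-off (f a) y≢b)) ⟨
      dipole a b (f a) y           ∎

  FormalSum : Set c
  FormalSum = List (D × Carrier)

  ⟦_⟧ : FormalSum → D → Carrier
  ⟦ ps ⟧ x = sumOver (λ (p , g) → δ p g x) ps

  mass : FormalSum → Carrier
  mass = sumOver proj₂

  ⟦⟧-++ : ∀ ps qs x → ⟦ ps ++ qs ⟧ x ≈ ⟦ ps ⟧ x ∙ ⟦ qs ⟧ x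
  ⟦⟧-++ ps qs x = sumOver-++ _ ps qs

  mass-++ : ∀ ps qs → mass (ps ++ qs) ≈ mass ps ∙ mass qs
  mass-++ = sumOver-++ proj₂

  ⟦⟧-concentrated : ∀ {p ps} → All (λ q → p ≡ proj₁ q) ps → ∀ x → ⟦ ps ⟧ x ≈ δ p (mass ps) x
  ⟦⟧-concentrated {p} {ps} at-p x = begin
    ⟦ ps ⟧ x                         ≈⟨ sumOver-congᴬ (All.map (λ p≡q → reflexive (≡.cong (λ a → δ a _ x) (≡.sym p≡q))) at-p) ⟩
    sumOver (λ (_ , g) → δ p g x) ps ≈⟨ δ-hom.sumOver-homoᵖ p proj₂ ps x ⟨
    δ p (mass ps) x                  ∎

  ⟦⟧-off : ∀ {x ps} → All (λ q → x ≢ proj₁ q) ps → ⟦ ps ⟧ x ≈ ε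
  ⟦⟧-off off-x = sumOver-ε (All.map (δ-off _) off-x)

  mass-vanishes : ∀ n ps → length ps ℕ.≤ n → (∀ x → ⟦ ps ⟧ x ≈ ε) → mass ps ≈ ε
  mass-vanishes _       []              _              _      = refl
  mass-vanishes (ℕ.suc n) ((p , g) ∷ rest) (ℕ.s≤s |rest|≤n) vanish = begin
    g ∙ mass rest                 ≈⟨ ∙-congˡ (sumOver-partition at-p? proj₂ rest) ⟩
    g ∙ (mass atP ∙ mass offP)    ≈⟨ assoc _ _ _ ⟨
    (g ∙ mass atP) ∙ mass offP    ≈⟨ ∙-cong collected (mass-vanishes n offP |offP|≤n offP-vanishes) ⟩
    ε ∙ ε                         ≈⟨ identityˡ ε ⟩
    ε                             ∎
    where
    at-p? : Decidable (λ (q : D × Carrier) → p ≡ proj₁ q)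
    at-p? q = p ≟ proj₁ q
    atP = filter at-p? rest
    offP = filter (∁? at-p?) rest

    |offP|≤n : length offP ℕ.≤ n
    |offP|≤n = ≤-trans (length-filter (∁? at-p?) rest) |rest|≤n

    regrouped : ∀ x → ⟦ (p , g) ∷ rest ⟧ x ≈ δ p (g ∙ mass atP) x ∙ ⟦ offP ⟧ x
    regrouped x = begin
      δ p g x ∙ ⟦ rest ⟧ x                      ≈⟨ ∙-congˡ (sumOver-partition at-p? _ rest) ⟩
      δ p g x ∙ (⟦ atP ⟧ x ∙ ⟦ offP ⟧ x)        ≈⟨ assoc _ _ _ ⟨
      (δ p g x ∙ ⟦ atP ⟧ x) ∙ ⟦ offP ⟧ x        ≈⟨ ∙-congʳ (∙-congˡ (⟦⟧-concentrated (all-filter at-p? rest) x)) ⟩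
      (δ p g x ∙ δ p (mass atP) x) ∙ ⟦ offP ⟧ x ≈⟨ ∙-congʳ (δ-hom.∙-homo p g _ x) ⟨
      δ p (g ∙ mass atP) x ∙ ⟦ offP ⟧ x         ∎

    collected : g ∙ mass atP ≈ ε
    collected = begin
      g ∙ mass atP                         ≈⟨ δ-at p _ ⟨
      δ p (g ∙ mass atP) p                 ≈⟨ identityʳ _ ⟨
      δ p (g ∙ mass atP) p ∙ ε             ≈⟨ ∙-congˡ (⟦⟧-off (all-filter (∁? at-p?) rest)) ⟨
      δ p (g ∙ mass atP) p ∙ ⟦ offP ⟧ p    ≈⟨ regrouped p ⟨
      ⟦ (p , g) ∷ rest ⟧ p                 ≈⟨ vanish p ⟩
      ε                                    ∎

    offP-vanishes : ∀ x → ⟦ offP ⟧ x ≈ ε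
    offP-vanishes x = begin
      ⟦ offP ⟧ x                           ≈⟨ identityˡ _ ⟨
      ε ∙ ⟦ offP ⟧ x                       ≈⟨ ∙-congʳ (δ-hom.ε-homo p x) ⟨
      δ p ε x ∙ ⟦ offP ⟧ x                 ≈⟨ ∙-congʳ (δ-hom.cong p collected x) ⟨
      δ p (g ∙ mass atP) x ∙ ⟦ offP ⟧ x    ≈⟨ regrouped x ⟨
      ⟦ (p , g) ∷ rest ⟧ x                 ≈⟨ vanish x ⟩
      ε                                    ∎

  negate : FormalSum → FormalSum
  negate = map (map₂ _⁻¹)

  ⁻¹-sumOver : ∀ {a} {A : Set a} (f : A → Carrier) xs → sumOver f xs ⁻¹ ≈ sumOver (_⁻¹ ∘ f) xs
  ⁻¹-sumOver = sumOver-homo _⁻¹ ⁻¹-cong ε⁻¹≈ε (λ g h → sym (⁻¹-∙-comm g h))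

  ⟦⟧-negate : ∀ ps x → ⟦ negate ps ⟧ x ≈ ⟦ ps ⟧ x ⁻¹
  ⟦⟧-negate ps x = begin
    ⟦ negate ps ⟧ x                       ≡⟨ sumOver-map _ (map₂ _⁻¹) ps ⟩
    sumOver (λ (p , g) → δ p (g ⁻¹) x) ps ≈⟨ sumOver-cong (λ (p , g) → δ-hom.⁻¹-homo p g x) ps ⟩
    sumOver (λ (p , g) → δ p g x ⁻¹) ps   ≈⟨ ⁻¹-sumOver _ ps ⟨
    ⟦ ps ⟧ x ⁻¹                           ∎

  mass-negate : ∀ ps → mass (negate ps) ≈ mass ps ⁻¹
  mass-negate ps = trans (reflexive (sumOver-map proj₂ (map₂ _⁻¹) ps)) (sym (⁻¹-sumOver proj₂ ps))

  mass-cong : ∀ ps qs → (∀ x → ⟦ ps ⟧ x ≈ ⟦ qs ⟧ x) → mass ps ≈ mass qs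
  mass-cong ps qs ps≈qs = x∙y⁻¹≈ε⇒x≈y _ _ (begin
    mass ps ∙ mass qs ⁻¹       ≈⟨ ∙-congˡ (mass-negate qs) ⟨
    mass ps ∙ mass (negate qs) ≈⟨ mass-++ ps (negate qs) ⟨
    mass (ps ++ negate qs)     ≈⟨ mass-vanishes _ (ps ++ negate qs) ≤-refl difference-vanishes ⟩
    ε                          ∎)
    where
    difference-vanishes : ∀ x → ⟦ ps ++ negate qs ⟧ x ≈ ε
    difference-vanishes x = begin
      ⟦ ps ++ negate qs ⟧ x      ≈⟨ ⟦⟧-++ ps (negate qs) x ⟩
      ⟦ ps ⟧ x ∙ ⟦ negate qs ⟧ x ≈⟨ ∙-congˡ (⟦⟧-negate qs x) ⟩
      ⟦ ps ⟧ x ∙ ⟦ qs ⟧ x ⁻¹     ≈⟨ x≈y⇒x∙y⁻¹≈ε (ps≈qs x) ⟩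
      ε                          ∎

  transport : D ↔ D → FormalSum → FormalSum
  transport θ = map (map₁ (Inverse.from θ))

  ⟦⟧-transport : ∀ θ ps x → ⟦ transport θ ps ⟧ x ≈ ⟦ ps ⟧ (Inverse.to θ x)
  ⟦⟧-transport θ ps x = trans (reflexive (sumOver-map _ (map₁ (Inverse.from θ)) ps))
    (sumOver-cong (λ (p , g) → δ-transport θ p g x) ps)

  mass-transport : ∀ θ ps → mass (transport θ ps) ≡ mass ps
  mass-transport θ ps = sumOver-map proj₂ (map₁ (Inverse.from θ)) ps

  pointMasses : DataVec G D → FormalSum
  pointMasses v = map (λ α → α , fn v α) (dom v)

  mass-pointMasses : ∀ v → mass (pointMasses v) ≡ weight G D v
  mass-pointMasses v = sumOver-map proj₂ _ (dom v)

  sumOver-δ-∉ : ∀ (f : D → Carrier) {L x} → x ∉ L → sumOver (λ α → δ α (f α) x) L ≈ ε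
  sumOver-δ-∉ f {L} x∉L = sumOver-ε (All.map (δ-off _) (¬Any⇒All¬ L x∉L))

  sumOver-δ-∈ : ∀ (f : D → Carrier) {L x} → Unique L → x ∈ L → sumOver (λ α → δ α (f α) x) L ≈ f x
  sumOver-δ-∈ f {a ∷ L} (a≢L ∷ _) (here ≡.refl) =
    trans (∙-cong (δ-at a (f a)) (sumOver-δ-∉ f (All¬⇒¬Any a≢L))) (identityʳ _)
  sumOver-δ-∈ f {a ∷ L} (a≢L ∷ unique) (there x∈L) =
    trans (∙-cong (δ-off (f a) (≢-sym (All.lookup a≢L x∈L))) (sumOver-δ-∈ f unique x∈L)) (identityˡ _)

  ⟦pointMasses⟧ : ∀ v x → ⟦ pointMasses v ⟧ x ≈ fn v x
  ⟦pointMasses⟧ v x with DecMembership._∈?_ _≟_ x (dom v)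
  ... | yes x∈dom = trans (reflexive (sumOver-map _ _ (dom v))) (sumOver-δ-∈ (fn v) (uniq v) x∈dom)
  ... | no  x∉dom = trans (reflexive (sumOver-map _ _ (dom v)))
                          (trans (sumOver-δ-∉ (fn v) x∉dom) (sym (fin v x x∉dom)))

  dipolePart : D → DataVec G D → D → Carrier
  dipolePart b v x = sumOver (λ α → dipole α b (fn v α) x) (dom v)

  dipoleDecomposition : ∀ b v x → fn v x ≈ dipolePart b v x ∙ δ b (weight G D v) x
  dipoleDecomposition b v x = begin
    fn v x
      ≈⟨ ⟦pointMasses⟧ v x ⟨
    ⟦ pointMasses v ⟧ x
      ≡⟨ sumOver-map _ _ (dom v) ⟩
    sumOver (λ α → δ α (fn v α) x) (dom v)
      ≈⟨ sumOver-cong (λ α → δ≈dipole∙δ α b (fn v α) x) (dom v) ⟩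
    sumOver (λ α → dipole α b (fn v α) x ∙ δ b (fn v α) x) (dom v)
      ≈⟨ sumOver-∙ _ _ (dom v) ⟩
    dipolePart b v x ∙ sumOver (λ α → δ b (fn v α) x) (dom v)
      ≈⟨ ∙-congˡ (δ-hom.sumOver-homoᵖ b (fn v) (dom v) x) ⟨
    dipolePart b v x ∙ δ b (weight G D v) x
      ∎

  termsFormalSum : List (DataVec G D × (D ↔ D)) → FormalSum
  termsFormalSum []             = []
  termsFormalSum ((v , θ) ∷ ts) = transport θ (pointMasses v) ++ termsFormalSum ts

  ⟦termsFormalSum⟧ : ∀ ts x → ⟦ termsFormalSum ts ⟧ x ≈ termSum G D ts x
  ⟦termsFormalSum⟧ []             x = refl
  ⟦termsFormalSum⟧ ((v , θ) ∷ ts) x = trans (⟦⟧-++ (transport θ (pointMasses v)) _ x)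
    (∙-cong (trans (⟦⟧-transport θ (pointMasses v) x) (⟦pointMasses⟧ v _)) (⟦termsFormalSum⟧ ts x))

  mass-termsFormalSum : ∀ ts → mass (termsFormalSum ts) ≈ sumOver (weight G D ∘ proj₁) ts
  mass-termsFormalSum []             = refl
  mass-termsFormalSum ((v , θ) ∷ ts) = trans (mass-++ (transport θ (pointMasses v)) _)
    (∙-cong (reflexive (≡.trans (mass-transport θ (pointMasses v)) (mass-pointMasses v)))
            (mass-termsFormalSum ts))

  weight-termSum : ∀ x ts → (∀ α → fn x α ≈ termSum G D ts α) →
                   weight G D x ≈ sumOver (weight G D ∘ proj₁) ts
  weight-termSum x ts x≈ts = begin
    weight G D x               ≡⟨ mass-pointMasses x ⟨
    mass (pointMasses x)       ≈⟨ mass-cong (pointMasses x) (termsFormalSum ts) same-function ⟩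
    mass (termsFormalSum ts)   ≈⟨ mass-termsFormalSum ts ⟩
    sumOver (weight G D ∘ proj₁) ts ∎
    where
    same-function : ∀ α → ⟦ pointMasses x ⟧ α ≈ ⟦ termsFormalSum ts ⟧ α
    same-function α = trans (⟦pointMasses⟧ x α) (trans (x≈ts α) (sym (⟦termsFormalSum⟧ ts α)))

module PermutationSums {c ℓ : Level} (G : AbelianGroup c ℓ) (D : Set) (V : List (DataVec G D)) where

  open AbelianGroup G
  open AbelianGroupProperties G
  open ListSum commutativeMonoid
  open PointwiseHomomorphisms G D

  private
    variable
      f g : D → Carrier

    Terms : Set (c ⊔ ℓ)
    Terms = List (DataVec G D × (D ↔ D))

    termSum-++ : ∀ ts us x → termSum G D (ts ++ us) x ≈ termSum G D ts x ∙ termSum G D us x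
    termSum-++ []             us x = sym (identityˡ _)
    termSum-++ ((v , θ) ∷ ts) us x = trans (∙-congˡ (termSum-++ ts us x)) (sym (assoc _ _ _))

    AllIn-++ : ∀ ts us → AllIn G D V ts → AllIn G D V us → AllIn G D V (ts ++ us)
    AllIn-++ []       us _              us∈V = us∈V
    AllIn-++ (t ∷ ts) us (t∈V , ts∈V) us∈V = t∈V , AllIn-++ ts us ts∈V us∈V

    precompose : D ↔ D → Terms → Terms
    precompose σ = map (map₂ (_↔-∘ σ))

    termSum-precompose : ∀ σ ts x → termSum G D (precompose σ ts) x ≡ termSum G D ts (Inverse.to σ x)
    termSum-precompose σ []             x = ≡.refl
    termSum-precompose σ ((v , θ) ∷ ts) x = ≡.cong (_ ∙_) (termSum-precompose σ ts x)

    AllIn-precompose : ∀ σ ts → AllIn G D V ts → AllIn G D V (precompose σ ts)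
    AllIn-precompose σ []       _              = _
    AllIn-precompose σ (t ∷ ts) (t∈V , ts∈V) = t∈V , AllIn-precompose σ ts ts∈V

  PermSum-resp : PermSum G D V f → (∀ x → f x ≈ g x) → PermSum G D V g
  PermSum-resp (ts , ts∈V , f≈ts) f≈g = ts , ts∈V , λ x → trans (sym (f≈g x)) (f≈ts x)

  PermSum-ε : PermSum G D V (λ _ → ε)
  PermSum-ε = [] , _ , λ _ → refl

  PermSum-∙ : PermSum G D V f → PermSum G D V g → PermSum G D V (λ x → f x ∙ g x)
  PermSum-∙ (ts , ts∈V , f≈ts) (us , us∈V , g≈us) =
    ts ++ us , AllIn-++ ts us ts∈V us∈V ,
    λ x → trans (∙-cong (f≈ts x) (g≈us x)) (sym (termSum-++ ts us x))

  PermSum-precompose : PermSum G D V f → (σ : D ↔ D) → PermSum G D V (f ∘ Inverse.to σ)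
  PermSum-precompose (ts , ts∈V , f≈ts) σ =
    precompose σ ts , AllIn-precompose σ ts ts∈V ,
    λ x → trans (f≈ts _) (reflexive (≡.sym (termSum-precompose σ ts x)))

  PermSum-member : ∀ {v} → v ∈ V → PermSum G D V (fn v)
  PermSum-member v∈V = (_ , ↔-id _) ∷ [] , (v∈V , _) , λ _ → sym (identityʳ _)

  PermSum-sumOver : ∀ {a} {A : Set a} {h : A → D → Carrier} →
                    (∀ y → PermSum G D V (h y)) → ∀ ys → PermSum G D V (λ x → sumOver (λ y → h y x) ys)
  PermSum-sumOver h-PS []       = PermSum-ε
  PermSum-sumOver h-PS (y ∷ ys) = PermSum-∙ (h-PS y) (PermSum-sumOver h-PS ys)

  module _ (reversible : Reversible G D V) where

    -- Reversibility supplies −v, and −(v ∘ θ) = (−v) ∘ θ.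
    PermSum-⁻¹ : PermSum G D V f → PermSum G D V (λ x → f x ⁻¹)
    PermSum-⁻¹ (ts , ts∈V , f≈ts) = PermSum-resp (negated ts ts∈V) (λ x → ⁻¹-cong (sym (f≈ts x)))
      where
      negated : ∀ ts → AllIn G D V ts → PermSum G D V (λ x → termSum G D ts x ⁻¹)
      negated []             _            = PermSum-resp PermSum-ε (λ _ → sym ε⁻¹≈ε)
      negated ((v , θ) ∷ ts) (v∈V , ts∈V) =
        PermSum-resp (PermSum-∙ (PermSum-precompose (proj₂ (reversible v v∈V)) θ) (negated ts ts∈V))
                     (λ x → ⁻¹-∙-comm _ _)

    PermSum-InSubgroup : ∀ {φ S} → IsPointwiseHom φ → (∀ {g} → S g → PermSum G D V (φ g)) →
                         ∀ {g} → InSubgroup G D S g → PermSum G D V (φ g)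
    PermSum-InSubgroup φ-hom S⊆PS (gen s)     = S⊆PS s
    PermSum-InSubgroup φ-hom S⊆PS zero        =
      PermSum-resp PermSum-ε (λ x → sym (IsPointwiseHom.ε-homo φ-hom x))
    PermSum-InSubgroup φ-hom S⊆PS (add g h)   =
      PermSum-resp (PermSum-∙ (PermSum-InSubgroup φ-hom S⊆PS g) (PermSum-InSubgroup φ-hom S⊆PS h))
                   (λ x → sym (IsPointwiseHom.∙-homo φ-hom _ _ x))
    PermSum-InSubgroup φ-hom S⊆PS (neg g)     =
      PermSum-resp (PermSum-⁻¹ (PermSum-InSubgroup φ-hom S⊆PS g))
                   (λ x → sym (IsPointwiseHom.⁻¹-homo φ-hom _ x))
    PermSum-InSubgroup φ-hom S⊆PS (resp g≈h g) =
      PermSum-resp (PermSum-InSubgroup φ-hom S⊆PS g) (IsPointwiseHom.cong φ-hom g≈h)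

module Characterisation {c ℓ : Level} (G : AbelianGroup c ℓ) (D : Set) (_≟_ : DecidableEquality D)
                        (V : List (DataVec G D)) where

  open AbelianGroup G
  open AbelianGroupProperties G using (\\-leftDividesʳ)
  open PointMasses G D _≟_
  open PermutationSums G D V
  open Transposition _≟_
  open import Relation.Binary.Reasoning.Setoid setoid

  necessity : ∀ x → PermSum G D V (fn x) →
              InSubgroup G D (Weights G D V) (weight G D x) × (∀ α → InSubgroup G D (Entries G D V) (fn x α))
  necessity x (ts , ts∈V , x≈ts) =
    resp (sym (weight-termSum x ts x≈ts)) (weights ts ts∈V) ,
    λ α → resp (sym (x≈ts α)) (entries ts ts∈V α)
    where
    weights : ∀ ts → AllIn G D V ts → InSubgroup G D (Weights G D V) (sumOver (weight G D ∘ proj₁) ts)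
    weights []             _            = zero
    weights ((v , θ) ∷ ts) (v∈V , ts∈V) = add (gen (v , v∈V , refl)) (weights ts ts∈V)
    entries : ∀ ts → AllIn G D V ts → ∀ α → InSubgroup G D (Entries G D V) (termSum G D ts α)
    entries []             _            α = zero
    entries ((v , θ) ∷ ts) (v∈V , ts∈V) α = add (gen (v , v∈V , Inverse.to θ α , refl)) (entries ts ts∈V α)

  module _ (reversible : Reversible G D V) (β : D) (β-free : ∀ v → v ∈ V → fn v β ≈ ε) where

    dipole-PermSum-entry : ∀ a {g} → Entries G D V g → PermSum G D V (dipole a β g)
    dipole-PermSum-entry a {g} (v , v∈V , δ₀ , g≈vδ₀) with a ≟ β | δ₀ ≟ β
    ... | yes ≡.refl | _          = PermSum-resp PermSum-ε (λ x → sym (dipole-self a g x))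
    ... | no  _      | yes ≡.refl = PermSum-resp PermSum-ε (λ x → sym (begin
      dipole a β g x ≈⟨ dipole-hom.cong a β (trans g≈vδ₀ (β-free v v∈V)) x ⟩
      dipole a β ε x ≈⟨ dipole-hom.ε-homo a β x ⟩
      ε              ∎))
    ... | no  a≢β    | no  δ₀≢β   =
      PermSum-resp (PermSum-∙ moved (PermSum-⁻¹ reversible (PermSum-precompose moved (transposition a β))))
                   (λ x → trans (dipole-transpose f moved-β a≢β x)
                                (dipole-hom.cong a β f-a x))
      where
      f : D → Carrier
      f = fn v ∘ transpose a δ₀
      moved : PermSum G D V f
      moved = PermSum-precompose (PermSum-member v∈V) (transposition a δ₀)
      moved-β : f β ≈ ε
      moved-β = trans (reflexive (≡.cong (fn v) (transpose-other (≢-sym a≢β) (≢-sym δ₀≢β))))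
                      (β-free v v∈V)
      f-a : f a ≈ g
      f-a = trans (reflexive (≡.cong (fn v) (transpose-left a δ₀))) (sym g≈vδ₀)

    dipolePart-PermSum : ∀ v → (∀ α → InSubgroup G D (Entries G D V) (fn v α)) →
                         PermSum G D V (dipolePart β v)
    dipolePart-PermSum v entries = PermSum-sumOver
      (λ α → PermSum-InSubgroup reversible (dipole-isPointwiseHom α β) (dipole-PermSum-entry α) (entries α))
      (dom v)

    δβ-PermSum : ∀ {g} → InSubgroup G D (Weights G D V) g → PermSum G D V (δ β g)
    δβ-PermSum = PermSum-InSubgroup reversible (δ-isPointwiseHom β) δβ-PermSum-weight
      where
      δβ-PermSum-weight : ∀ {g} → Weights G D V g → PermSum G D V (δ β g)
      δβ-PermSum-weight (v , v∈V , g≈wv) = PermSum-resp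
        (PermSum-∙ (PermSum-⁻¹ reversible (dipolePart-PermSum v λ α → gen (v , v∈V , α , refl)))
                   (PermSum-member v∈V))
        (λ x → trans (∙-congˡ (dipoleDecomposition β v x))
                     (trans (\\-leftDividesʳ _ _) (δ-hom.cong β (sym g≈wv) x)))

    sufficiency : ∀ x → InSubgroup G D (Weights G D V) (weight G D x) →
                  (∀ α → InSubgroup G D (Entries G D V) (fn x α)) → PermSum G D V (fn x)
    sufficiency x weight∈W entries = PermSum-resp
      (PermSum-∙ (dipolePart-PermSum x entries) (δβ-PermSum weight∈W))
      (λ y → sym (dipoleDecomposition β x y))

theorem15 : {c ℓ : Level} (G : AbelianGroup c ℓ) (D : Set) → D ↣ ℕ →
    (V : List (DataVec G D)) → Reversible G D V →
    Σ D (λ β → ∀ v → v ∈ V → AbelianGroup._≈_ G (fn v β) (AbelianGroup.ε G)) →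
    (x : DataVec G D) →
    PermSum G D V (fn x) ⇔
      (InSubgroup G D (Weights G D V) (weight G D x) ×
       (∀ α → InSubgroup G D (Entries G D V) (fn x α)))
theorem15 G D D↣ℕ V reversible (β , β-free) x =
  mk⇔ (necessity x) (λ (weight∈W , entries) → sufficiency reversible β β-free x weight∈W entries)
  -- Countability of D is only used to decide equality of points.
  where open Characterisation G D (via-injection D↣ℕ ℕ._≟_) V
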